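{- Let $\Lambda$ be a (path) algebra of affine type $\widetilde{D}_n$ (with $n+1$ vertices), whose cluster category is modelled by the twice-punctured disk $\mathbb{D}(n)$ with punctures $P,Q$ and $n-2$ marked points on the boundary. Then the translation quiver $\Gamma(\mathbb{D}(n))=\Gamma_0\sqcup\Gamma_1$ of interior arcs of $\mathbb{D}(n)$ is isomorphic, as a translation quiver, to the disjoint union $\mathcal{T}_2\sqcup\mathcal{T}_3$ of the two tubes of rank $2$ in the Auslander–Reiten quiver of the cluster category of $\Lambda$.
   Context: The regular part of the Auslander–Reiten quiver of the cluster category of an algebra of affine type $\widetilde{D}_n$ consists of a $\mathbb{P}^1(k)$-family of stable tubes: one tube $\mathcal{T}_1$ of rank $n-2$, two tubes $\mathcal{T}_2,\mathcal{T}_3$ of rank $2$, and all others of rank $1$ (translation is the Auslander–Reiten translation $\tau$). Interior arcs of $\mathbb{D}(n)$ are (generalized, possibly self-crossing) tagged curves up to homotopy fixing endpoints with both endpoints at punctures, possibly cutting out a once-punctured monogon, in which case the two ends carry different tags. They are encoded as $[x,y]$: in the universal cover of a cylinder with $P$ on the lower boundary (preimages = odd integers) and $Q$ on the upper boundary (preimages = even integers), $[x,y]$ is the arc from the puncture of $x$, winding counterclockwise around both punctures $\lfloor |\,\|y\|-\|x\|\,|/2\rfloor$ times, to the puncture of $y$, where for $a\in\mathbb{Z}\sqcup\mathbb{Z}^\ast$, $\|a\|$ is the underlying integer, $\operatorname{tag}(a)$ is notched iff $a\in\mathbb{Z}^\ast$, and $a^\ast$ is $a$ with tag changed. Normal form: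 $x\in\{0,0^\ast,1,1^\ast\}$, $y\in\mathbb{Z}_{>0}\sqcup(\mathbb{Z}_{>0})^\ast$, $\|x\|<\|y\|$; if $\|y\|-\|x\|$ is odd then $\|x\|=0$ when the tags of $x,y$ agree and $\|x\|=1$ when they differ; if $\|y\|-\|x\|$ is even then the tags of $x,y$ differ. The quiver $\Gamma(\mathbb{D}(n))$ has as vertices the arcs $[x,y]$ in normal form, with an arrow $[x,y]\to[a,b]$ if: when $\|x\|=0$, ($a=x$, $b=y^\ast+1$) or ($a=x^\ast$, $b=y-1$); when $\|x\|=1$, ($a=x$, $b=y+1$) or ($a=x^\ast$, $b=y^\ast-1$) (here $y\pm1$ shifts the integer keeping the tag). Its translation is $\tau([x,y])=[x^\ast,y^\ast]$. $\Gamma_0$ is the component of arcs with $\|x\|=0$ and $\Gamma_1$ the component of arcs with $\|x\|=1$. -}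

module Defs where

open import Data.Nat as ℕ using (ℕ; zero; suc; NonZero; _∸_)
open import Data.Nat.DivMod using (_mod_)
open import Data.Fin using (Fin; toℕ)
open import Data.Integer as ℤ using (ℤ; +_; _+_; _-_; _<_)
open import Data.Integer.Divisibility using (_∣_)
open import Data.Bool using (Bool; true; false; not)
open import Data.Product using (Σ; _×_; _,_; proj₁; proj₂)
open import Data.Sum using (_⊎_; inj₁; inj₂)
open import Data.Empty using (⊥)
open import Relation.Binary.PropositionalEquality using (_≡_; _≢_; refl; cong)
open import Relation.Nullary using (¬_)
open import Function.Bundles using (_⇔_)

-- Tagged endpoints: an element of ℤ ⊔ ℤ*  (notched = true  iff  in ℤ*)

record End : Set where
  constructor end
  field
    val     : ℤ
    notched : Bool
open End public

_* : End → End
end a t * = end a (not t)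

shift+ : End → End
shift+ (end a t) = end (a + + 1) t

shift- : End → End
shift- (end a t) = end (a - + 1) t

Even : ℤ → Set
Even d = + 2 ∣ d

Odd : ℤ → Set
Odd d = ¬ Even d

record IsNormalForm (x y : End) : Set where
  field
    x-small   : val x ≡ + 0 ⊎ val x ≡ + 1
    y-pos     : + 0 < val y
    x<y       : val x < val y
    odd-case  : Odd (val y - val x) →
                  (notched x ≡ notched y → val x ≡ + 0)
                × (notched x ≢ notched y → val x ≡ + 1)
    even-case : Even (val y - val x) → notched x ≢ notched y
open IsNormalForm public

record Arc : Set where
  constructor [_,_]⟨_⟩
  field
    src : End
    tgt : End
    nf  : IsNormalForm src tgt
open Arc public

not-inj : ∀ {a b} → not a ≡ not b → a ≡ b
not-inj {false} {false} _ = refl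
not-inj {true}  {true}  _ = refl
not-inj {false} {true}  ()
not-inj {true}  {false} ()

τ-nf : ∀ {x y} → IsNormalForm x y → IsNormalForm (x *) (y *)
τ-nf {end a s} {end b t} p = record
  { x-small   = x-small p
  ; y-pos     = y-pos p
  ; x<y       = x<y p
  ; odd-case  = λ o → (λ e → proj₁ (odd-case p o) (not-inj e))
                    , (λ ne → proj₂ (odd-case p o) (λ e → ne (cong not e)))
  ; even-case = λ ev e → even-case p ev (not-inj e)
  }

-- Translation quivers (arrows given as a Set-valued relation, translation
-- defined everywhere = stable), with a notion of equality of vertices.

record TranslationQuiver : Set₁ where
  field
    Vertex : Set
    _≈_    : Vertex → Vertex → Set
    Arrow  : Vertex → Vertex → Set
    τ      : Vertex → Vertex

open TranslationQuiver

-- Isomorphism of translation quivers (for quivers with at most one arrow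
-- between any two vertices, as is the case for all quivers below).
record _≅_ (A B : TranslationQuiver) : Set where
  field
    map        : Vertex A → Vertex B
    congruent  : ∀ u v → _≈_ A u v → _≈_ B (map u) (map v)
    injective  : ∀ u v → _≈_ B (map u) (map v) → _≈_ A u v
    surjective : ∀ w → Σ (Vertex A) (λ v → _≈_ B (map v) w)
    arrows     : ∀ u v → Arrow A u v ⇔ Arrow B (map u) (map v)
    commutes-τ : ∀ u → _≈_ B (map (τ A u)) (τ B (map u))

data ΓArrow (u v : Arc) : Set where
  arr0a : val (src u) ≡ + 0 → src v ≡ src u     → tgt v ≡ shift+ ((tgt u) *) → ΓArrow u v
  arr0b : val (src u) ≡ + 0 → src v ≡ (src u) * → tgt v ≡ shift- (tgt u)    → ΓArrow u v
  arr1a : val (src u) ≡ + 1 → src v ≡ src u     → tgt v ≡ shift+ (tgt u)    → ΓArrow u v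
  arr1b : val (src u) ≡ + 1 → src v ≡ (src u) * → tgt v ≡ shift- ((tgt u) *) → ΓArrow u v

τΓ : Arc → Arc
τΓ [ x , y ]⟨ p ⟩ = [ x * , y * ]⟨ τ-nf p ⟩

-- Γ(𝔻(n)) = Γ₀ ⊔ Γ₁ (the combinatorial description does not depend on n)
Γ𝔻 : ℕ → TranslationQuiver
Γ𝔻 n = record
  { Vertex = Arc
  ; _≈_    = λ u v → (src u ≡ src v) × (tgt u ≡ tgt v)
  ; Arrow  = ΓArrow
  ; τ      = τΓ
  }

-- Stable tube of rank r :  ℤA∞ / (τ^r).
-- Vertex (i , j) with i ∈ ℤ/r and j ∈ ℕ standing for the level j+1 ≥ 1.
-- Arrows (i,j) → (i,j+1) and (i,j+1) → (i+1,j); τ(i,j) = (i-1,j).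

module _ (r : ℕ) .{{_ : NonZero r}} where

  sucᵣ : Fin r → Fin r
  sucᵣ i = suc (toℕ i) mod r

  predᵣ : Fin r → Fin r
  predᵣ i = (toℕ i ℕ.+ (r ∸ 1)) mod r

  data TubeArrow : Fin r × ℕ → Fin r × ℕ → Set where
    up   : ∀ i j → TubeArrow (i , j) (i , suc j)
    down : ∀ i j → TubeArrow (i , suc j) (sucᵣ i , j)

  Tube : TranslationQuiver
  Tube = record
    { Vertex = Fin r × ℕ
    ; _≈_    = _≡_
    ; Arrow  = TubeArrow
    ; τ      = λ v → predᵣ (proj₁ v) , proj₂ v
    }

module _ (A B : TranslationQuiver) where
  private
    module A = TranslationQuiver A
    module B = TranslationQuiver B

  ⊔-≈ : A.Vertex ⊎ B.Vertex → A.Vertex ⊎ B.Vertex → Set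
  ⊔-≈ (inj₁ a) (inj₁ a') = a A.≈ a'
  ⊔-≈ (inj₂ b) (inj₂ b') = b B.≈ b'
  ⊔-≈ _ _ = ⊥

  ⊔-Arrow : A.Vertex ⊎ B.Vertex → A.Vertex ⊎ B.Vertex → Set
  ⊔-Arrow (inj₁ a) (inj₁ a') = A.Arrow a a'
  ⊔-Arrow (inj₂ b) (inj₂ b') = B.Arrow b b'
  ⊔-Arrow _ _ = ⊥

  ⊔-τ : A.Vertex ⊎ B.Vertex → A.Vertex ⊎ B.Vertex
  ⊔-τ (inj₁ a) = inj₁ (A.τ a)
  ⊔-τ (inj₂ b) = inj₂ (B.τ b)

  _⊔_ : TranslationQuiver
  _⊔_ = record { Vertex = A.Vertex ⊎ B.Vertex ; _≈_ = ⊔-≈ ; Arrow = ⊔-Arrow ; τ = ⊔-τ }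

-- An arc [x,y] in normal form is determined by ‖x‖ ∈ {0,1}, tag(x) and the
-- level ‖y‖ − ‖x‖ − 1 ∈ ℕ: the normal-form conditions force tag(y), which is
-- opposite to tag(x) when ‖x‖ = 1 and agrees with tag(x) iff ‖y‖ is odd when
-- ‖x‖ = 0. Sending [x,y] to the vertex (tag(x), level) of the ‖x‖-th tube,
-- the arrow [x,y] → [x,·] raises the level keeping tag(x), the arrow
-- [x,y] → [x*,·] lowers it flipping tag(x), and τ flips tag(x) keeping the
-- level: these are exactly the arrows and the translation of ℤA∞/(τ²), with
-- its two τ-orbits indexed by tag(x).
module Submission where

open import Defs
open import Data.Bool using (Bool; true; false; not; _≟_)
open import Data.Bool.Properties using (not-involutive; not-¬; ¬-not)
open import Data.Fin using (zero)
open import Data.Fin.Properties using (2↔Bool)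
open import Data.Integer using (+_; -[1+_]; _-_; +<+)
import Data.Integer.Properties as ℤ
open import Data.Nat using (ℕ; zero; suc; _≤_; s≤s; z≤n)
open import Data.Nat.Properties using (+-comm)
open import Data.Nat.Divisibility using (_∣_; _∣?_; _∣0; ∣-refl; ∣1⇒≡1; ∣m+n∣m⇒∣n; ∣m∣n⇒∣m+n)
open import Data.Product using (Σ; _×_; _,_; proj₁; proj₂)
open import Data.Product.Properties using (,-injectiveˡ; ,-injectiveʳ)
open import Data.Sum using (inj₁; inj₂)
open import Function using (_∘_; case_of_)
open import Function.Bundles using (_⇔_; mk⇔; module Equivalence; Inverse; Injection)
open import Function.Properties.Inverse using (↔-sym; ↔⇒↣)
import Function.Properties.Equivalence as ⇔
open import Relation.Binary.PropositionalEquality using (_≡_; _≢_; refl; sym; trans; cong; subst; ≢-sym)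
open import Relation.Nullary using (¬_; yes; no; contradiction)
open import Relation.Nullary.Decidable using (decidable-stable)

open Inverse 2↔Bool using () renaming (from to toFin; to to fromFin; strictlyInverseʳ to toFin∘fromFin)
open Injection (↔⇒↣ (↔-sym 2↔Bool)) using () renaming (injective to toFin-injective)

module T = TranslationQuiver (Tube 2 ⊔ Tube 2)

predᵣ-toFin : ∀ s → predᵣ 2 (toFin s) ≡ toFin (not s)
predᵣ-toFin false = refl
predᵣ-toFin true  = refl

data Tube₂Arrow : Bool × ℕ → Bool × ℕ → Set where
  up   : ∀ s k → Tube₂Arrow (s , k) (s , suc k)
  down : ∀ s k → Tube₂Arrow (s , suc k) (not s , k)

tube₂Arrow⇔tubeArrow : ∀ {s k s' k'} →
                       Tube₂Arrow (s , k) (s' , k') ⇔ TubeArrow 2 (toFin s , k) (toFin s' , k')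
tube₂Arrow⇔tubeArrow = mk⇔ to from
  where
  to : ∀ {s k s' k'} → Tube₂Arrow (s , k) (s' , k') → TubeArrow 2 (toFin s , k) (toFin s' , k')
  to (up _ _)       = up _ _
  to (down false _) = down _ _
  to (down true _)  = down _ _
  from : ∀ {s k s' k'} → TubeArrow 2 (toFin s , k) (toFin s' , k') → Tube₂Arrow (s , k) (s' , k')
  from {false} {s' = false} (up _ _)   = up _ _
  from {false} {s' = true}  (down _ _) = down _ _
  from {true}  {s' = true}  (up _ _)   = up _ _
  from {true}  {s' = false} (down _ _) = down _ _

tagΓ₀ : Bool → ℕ → Bool
tagΓ₀ s zero    = not s
tagΓ₀ s (suc m) = not (tagΓ₀ s m)

tagΓ₀-not : ∀ s m → tagΓ₀ (not s) m ≡ not (tagΓ₀ s m)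
tagΓ₀-not s zero    = refl
tagΓ₀-not s (suc m) = cong not (tagΓ₀-not s m)

tagΓ₀-even : ∀ s {m} → 2 ∣ m → tagΓ₀ s m ≡ not s
tagΓ₀-even s {zero}        _     = refl
tagΓ₀-even s {suc zero}    2∣1   = case ∣1⇒≡1 2∣1 of λ ()
tagΓ₀-even s {suc (suc m)} 2∣2+m =
  trans (not-involutive _) (tagΓ₀-even s (∣m+n∣m⇒∣n 2∣2+m ∣-refl))

tagΓ₀-odd : ∀ s {m} → ¬ 2 ∣ m → tagΓ₀ s m ≡ s
tagΓ₀-odd s {zero}        2∤0   = contradiction (2 ∣0) 2∤0
tagΓ₀-odd s {suc zero}    _     = not-involutive s
tagΓ₀-odd s {suc (suc m)} 2∤2+m =
  trans (not-involutive _) (tagΓ₀-odd s (2∤2+m ∘ ∣m∣n⇒∣m+n ∣-refl))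

Even[m-0]⇔2∣m : ∀ m → Even (+ m - + 0) ⇔ 2 ∣ m
Even[m-0]⇔2∣m m = mk⇔ (subst Even m-0≡m) (subst Even (sym m-0≡m))
  where m-0≡m = ℤ.+-identityʳ (+ m)

src₀ : Bool → End
src₀ s = end (+ 0) s

tgt₀ : Bool → ℕ → End
tgt₀ s k = end (+ suc k) (tagΓ₀ s (suc k))

src₁ : Bool → End
src₁ s = end (+ 1) s

tgt₁ : Bool → ℕ → End
tgt₁ s k = end (+ suc (suc k)) (not s)

normal₀ : ∀ s k → IsNormalForm (src₀ s) (tgt₀ s k)
normal₀ s k = record
  { x-small   = inj₁ refl
  ; y-pos     = +<+ (s≤s z≤n)
  ; x<y       = +<+ (s≤s z≤n)
  ; odd-case  = λ odd → (λ _ → refl) , λ s≢t → contradiction (sym (tagΓ₀-odd s (odd ∘ from))) s≢t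
  ; even-case = λ even s≡t → not-¬ refl (trans s≡t (tagΓ₀-even s (to even)))
  }
  where open Equivalence (Even[m-0]⇔2∣m (suc k))

normal₁ : ∀ s k → IsNormalForm (src₁ s) (tgt₁ s k)
normal₁ s k = record
  { x-small   = inj₂ refl
  ; y-pos     = +<+ (s≤s z≤n)
  ; x<y       = +<+ (s≤s (s≤s z≤n))
  ; odd-case  = λ _ → (λ s≡¬s → contradiction s≡¬s (not-¬ refl)) , λ _ → refl
  ; even-case = λ _ → not-¬ refl
  }

data Canonical : End → End → Set where
  Γ₀ : ∀ s k → Canonical (src₀ s) (tgt₀ s k)
  Γ₁ : ∀ s k → Canonical (src₁ s) (tgt₁ s k)

canonical₀ : ∀ {s y} → IsNormalForm (src₀ s) y → Canonical (src₀ s) y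
canonical₀ {y = end (+ zero) _} p with y-pos p
... | +<+ ()
canonical₀ {y = end -[1+ _ ] _} p with y-pos p
... | ()
canonical₀ {s} {end (+ suc k) t} p with forced-tag
  where
  open Equivalence (Even[m-0]⇔2∣m (suc k))
  forced-tag : t ≡ tagΓ₀ s (suc k)
  forced-tag with 2 ∣? suc k
  ... | yes even = trans (¬-not (≢-sym (even-case p (from even)))) (sym (tagΓ₀-even s even))
  ... | no odd   = trans t≡s (sym (tagΓ₀-odd s odd))
    where
    t≡s : t ≡ s
    t≡s = decidable-stable (t ≟ s) λ t≢s → case proj₂ (odd-case p (odd ∘ to)) (≢-sym t≢s) of λ ()
... | refl = Γ₀ s k

canonical₁ : ∀ {s y} → IsNormalForm (src₁ s) y → Canonical (src₁ s) y
canonical₁ {y = end (+ zero) _} p with x<y p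
... | +<+ ()
canonical₁ {y = end (+ suc zero) _} p with x<y p
... | +<+ (s≤s ())
canonical₁ {y = end -[1+ _ ] _} p with x<y p
... | ()
canonical₁ {s} {end (+ suc (suc k)) t} p with ¬-not (≢-sym tags-differ)
  where
  tags-differ : s ≢ t
  tags-differ s≡t with 2 ∣? suc k
  ... | yes even = even-case p even s≡t
  ... | no odd   = case proj₁ (odd-case p odd) s≡t of λ ()
... | refl = Γ₁ s k

canonical : ∀ {x y} → IsNormalForm x y → Canonical x y
canonical {end _ _} p with x-small p
... | inj₁ refl = canonical₀ p
... | inj₂ refl = canonical₁ p

coordinates : End → End → T.Vertex
coordinates (end (+ 0) s) (end (+ suc k) _)       = inj₁ (toFin s , k)
coordinates (end (+ 1) s) (end (+ suc (suc k)) _) = inj₂ (toFin s , k)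
coordinates _             _                       = inj₁ (zero , 0)   -- junk: no arc in normal form

arcCoordinates : Arc → T.Vertex
arcCoordinates u = coordinates (src u) (tgt u)

T-≈-refl : ∀ w → w T.≈ w
T-≈-refl (inj₁ _) = refl
T-≈-refl (inj₂ _) = refl

arcCoordinates-congruent : ∀ u v → src u ≡ src v × tgt u ≡ tgt v →
                           arcCoordinates u T.≈ arcCoordinates v
arcCoordinates-congruent [ x , y ]⟨ _ ⟩ [ .x , .y ]⟨ _ ⟩ (refl , refl) = T-≈-refl (coordinates x y)

coordinates-injective : ∀ {x y x' y'} → Canonical x y → Canonical x' y' →
                        coordinates x y T.≈ coordinates x' y' → x ≡ x' × y ≡ y'
coordinates-injective (Γ₀ _ _) (Γ₀ _ _) eq with toFin-injective (,-injectiveˡ eq) | ,-injectiveʳ eq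
... | refl | refl = refl , refl
coordinates-injective (Γ₁ _ _) (Γ₁ _ _) eq with toFin-injective (,-injectiveˡ eq) | ,-injectiveʳ eq
... | refl | refl = refl , refl
coordinates-injective (Γ₀ _ _) (Γ₁ _ _) ()
coordinates-injective (Γ₁ _ _) (Γ₀ _ _) ()

arcCoordinates-injective : ∀ u v → arcCoordinates u T.≈ arcCoordinates v →
                           src u ≡ src v × tgt u ≡ tgt v
arcCoordinates-injective [ _ , _ ]⟨ p ⟩ [ _ , _ ]⟨ q ⟩ = coordinates-injective (canonical p) (canonical q)

arcCoordinates-surjective : ∀ w → Σ Arc (λ v → arcCoordinates v T.≈ w)
arcCoordinates-surjective (inj₁ (i , k)) = [ _ , _ ]⟨ normal₀ (fromFin i) k ⟩ , cong (_, k) (toFin∘fromFin i)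
arcCoordinates-surjective (inj₂ (i , k)) = [ _ , _ ]⟨ normal₁ (fromFin i) k ⟩ , cong (_, k) (toFin∘fromFin i)

arcCoordinates-τ : ∀ u → arcCoordinates (τΓ u) T.≈ T.τ (arcCoordinates u)
arcCoordinates-τ [ _ , _ ]⟨ p ⟩ with canonical p
... | Γ₀ s k = cong (_, k) (sym (predᵣ-toFin s))
... | Γ₁ s k = cong (_, k) (sym (predᵣ-toFin s))

shift+-end : ∀ m t → shift+ (end (+ m) t) ≡ end (+ suc m) t
shift+-end m t = cong (λ l → end (+ l) t) (+-comm m 1)

ΓArrow-val-src : ∀ {u v} → ΓArrow u v → val (src v) ≡ val (src u)
ΓArrow-val-src (arr0a _ e _) = cong val e
ΓArrow-val-src (arr0b _ e _) = cong val e
ΓArrow-val-src (arr1a _ e _) = cong val e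
ΓArrow-val-src (arr1b _ e _) = cong val e

Γ₀-arrow⇔tube₂Arrow : ∀ {s k s' k' p p'} →
  ΓArrow [ src₀ s , tgt₀ s k ]⟨ p ⟩ [ src₀ s' , tgt₀ s' k' ]⟨ p' ⟩ ⇔ Tube₂Arrow (s , k) (s' , k')
Γ₀-arrow⇔tube₂Arrow = mk⇔ to from
  where
  to : ∀ {s k s' k' p p'} →
       ΓArrow [ src₀ s , tgt₀ s k ]⟨ p ⟩ [ src₀ s' , tgt₀ s' k' ]⟨ p' ⟩ → Tube₂Arrow (s , k) (s' , k')
  to {k = k} (arr0a _ refl e) with trans e (shift+-end (suc k) _)
  ... | refl = up _ _
  to {k = zero}  (arr0b _ refl ())
  to {k = suc k} (arr0b _ refl e) with ℤ.+-injective (cong val e)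
  ... | refl = down _ _
  from : ∀ {s k s' k' p p'} →
         Tube₂Arrow (s , k) (s' , k') → ΓArrow [ src₀ s , tgt₀ s k ]⟨ p ⟩ [ src₀ s' , tgt₀ s' k' ]⟨ p' ⟩
  from (up _ _)   = arr0a refl refl (sym (shift+-end _ _))
  from (down s k) = arr0b refl refl (cong (end (+ suc k)) (tagΓ₀-not s (suc k)))

Γ₁-arrow⇔tube₂Arrow : ∀ {s k s' k' p p'} →
  ΓArrow [ src₁ s , tgt₁ s k ]⟨ p ⟩ [ src₁ s' , tgt₁ s' k' ]⟨ p' ⟩ ⇔ Tube₂Arrow (s , k) (s' , k')
Γ₁-arrow⇔tube₂Arrow = mk⇔ to from
  where
  to : ∀ {s k s' k' p p'} →
       ΓArrow [ src₁ s , tgt₁ s k ]⟨ p ⟩ [ src₁ s' , tgt₁ s' k' ]⟨ p' ⟩ → Tube₂Arrow (s , k) (s' , k')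
  to {k = k} (arr1a _ refl e) with trans e (shift+-end (suc (suc k)) _)
  ... | refl = up _ _
  to {k = zero}  (arr1b _ refl ())
  to {k = suc _} (arr1b _ refl refl) = down _ _
  from : ∀ {s k s' k' p p'} →
         Tube₂Arrow (s , k) (s' , k') → ΓArrow [ src₁ s , tgt₁ s k ]⟨ p ⟩ [ src₁ s' , tgt₁ s' k' ]⟨ p' ⟩
  from (up _ _)   = arr1a refl refl (sym (shift+-end _ _))
  from (down _ _) = arr1b refl refl refl

arcCoordinates-arrows : ∀ u v → ΓArrow u v ⇔ T.Arrow (arcCoordinates u) (arcCoordinates v)
arcCoordinates-arrows [ _ , _ ]⟨ p ⟩ [ _ , _ ]⟨ q ⟩ with canonical p | canonical q
... | Γ₀ _ _ | Γ₀ _ _ = ⇔.trans Γ₀-arrow⇔tube₂Arrow tube₂Arrow⇔tubeArrow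
... | Γ₁ _ _ | Γ₁ _ _ = ⇔.trans Γ₁-arrow⇔tube₂Arrow tube₂Arrow⇔tubeArrow
... | Γ₀ _ _ | Γ₁ _ _ = mk⇔ (λ a → case ΓArrow-val-src a of λ ()) λ ()
... | Γ₁ _ _ | Γ₀ _ _ = mk⇔ (λ a → case ΓArrow-val-src a of λ ()) λ ()

mainTheorem2 : (n : ℕ) → 4 ≤ n → Γ𝔻 n ≅ (Tube 2 ⊔ Tube 2)
mainTheorem2 _ _ = record
  { map        = arcCoordinates
  ; congruent  = arcCoordinates-congruent
  ; injective  = arcCoordinates-injective
  ; surjective = arcCoordinates-surjective
  ; arrows     = arcCoordinates-arrows
  ; commutes-τ = arcCoordinates-τ
  }
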